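{- Let $D$ be a diagnoser for a partially observable plant $P$, let $\beta$ be a diagnosis condition, $d\ge 0$, and let $\varphi$ be a trace-diagnosable alarm condition with alarm $A$. If $D$ is maximal for $\varphi$ in $P$, then $D$ is complete for $\varphi$, namely: (i) if $\varphi=\mathrm{ExactDel}(A,\beta,d)$, then $D\otimes P\models G\big((\beta\to X^d[KY^d\beta]_o)\to(\beta\to X^d[A]_o)\big)$; (ii) if $\varphi=\mathrm{BoundDel}(A,\beta,d)$, then $D\otimes P\models G\big((\beta\to F^{\le d}[KO^{\le d}\beta]_o)\to(\beta\to F^{\le d}[A]_o)\big)$; (iii) if $\varphi=\mathrm{FiniteDel}(A,\beta)$, then $D\otimes P\models G\big((\beta\to F[KO\beta]_o)\to(\beta\to F[A]_o)\big)$.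
   Context: An LTS is $S=\langle V,E,I,\mathcal T\rangle$ (finite set $V$ of variables over a finite domain, events $E$, initial formula $I$, transition formulas $\mathcal T(e)$ over $V\cup V'$). A trace is an infinite sequence $\sigma=s_0,e_0,s_1,e_1,\dots$ with $s_0\models I$ and $\langle s_k,s_{k+1}\rangle\models\mathcal T(e_k)$ (deadlock freedom assumed); $\sigma^k=s_0,e_0,\dots,s_k$. Deterministic: exactly one initial state and exactly one successor per event from each reachable state. A plant $P=\langle V^P,E^P,I^P,\mathcal T^P,E^P_o\rangle$ has observable events $E^P_o\subseteq E^P$. $\mathit{obs}(\sigma^k)$ = subsequence of observable events among $e_0,\dots,e_{k-1}$; $\mathit{ObsPoint}(\sigma,i)$ iff $i>0$ and $e_{i-1}\in E_o$; $((\sigma_1,i),(\sigma_2,j))\in\mathit{ObsEq}$ iff ($\mathit{ObsPoint}(\sigma_1,i)\Leftrightarrow\mathit{ObsPoint}(\sigma_2,j)$) and $\mathit{obs}(\sigma_1^i)=\mathit{obs}(\sigma_2^j)$. A diagnoser for $P$ is a deterministic LTS $D$ with event set $E^P_o$, variables disjoint from $V^P$, containing Boolean alarm variables. $D\otimes P$ is the asynchronous product (on unobservable plant events $D$'s variables are unchanged, on observable events both move), regarded as partially observable with observable events $E^P_o$. For a trace $\sigma_P$ of $P$, $D(\sigma_P)$ is the unique trace of $D$ with $D(\sigma_P)\otimes\sigma_P$ a trace of $D\otimes P$. Logic: LTL with past, reflexive semantics ($Y\beta$ at $i$ iff $i>0$ and $\beta$ at $i-1$; $O$, $F$, $G$ include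 the current position; $X$ next; $Y^n,X^n$ iterates; $O^{\le n}\beta=\beta\vee Y\beta\vee\dots\vee Y^n\beta$; $F^{\le n}\beta=\beta\vee X\beta\vee\dots\vee X^n\beta$; $\sigma,i\models e$ iff $e_i=e$), extended with $K$: $\sigma_1,i\models K\beta$ iff for every trace $\sigma_2$ of the system and every $j$ with $((\sigma_1,i),(\sigma_2,j))\in\mathit{ObsEq}$, $\sigma_2,j\models\beta$. $[\phi]_o$ abbreviates $\phi\wedge Y\bigvee_{e\in E_o}e$. A system satisfies a formula iff all its traces do at position 0. A diagnosis condition is a formula over plant propositions built with $\wedge,\neg,O,Y$. Temporal condition $\tau$: $Y^d\beta$ for ExactDel, $O^{\le d}\beta$ for BoundDel, $O\beta$ for FiniteDel. A trace-diagnosable alarm condition is one whose completeness requirement is the formula in the corresponding item of the claim. A diagnoser $D'$ with alarm $A$ is correct for $\varphi$ if $D'\otimes P\models G([A]_o\to\tau)$. $D$ is maximal for $\varphi$ in $P$ iff for every trace $\sigma_P$ of $P$ and every observation point $i$, if $A$ is false at position $i$ of $D(\sigma_P)\otimes\sigma_P$ then no diagnoser $D'$ of $P$ correct for $\varphi$ has $A$ true at position $i$ of $D'(\sigma_P)\otimes\sigma_P$. -}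

module Defs where

open import Data.Nat using (ℕ; zero; suc; _≤_)
open import Data.Fin using (Fin; toℕ)
open import Data.Bool using (Bool; true; false; T; if_then_else_)
open import Data.List using (List; []; _∷_)
open import Data.Product using (Σ; _×_; _,_; proj₁; proj₂)
open import Data.Empty using (⊥)
open import Relation.Binary.PropositionalEquality using (_≡_)
open import Relation.Nullary using (¬_)

Val : (n : ℕ) → (Fin n → ℕ) → Set
Val n dom = (x : Fin n) → Fin (dom x)

_≈V_ : ∀ {n} {dom : Fin n → ℕ} → Val n dom → Val n dom → Set
s ≈V t = ∀ x → s x ≡ t x

-- LTS ⟨V,E,I,T⟩ with event set Ev; formulas over V (resp. V ∪ V')
-- are represented by their (Boolean) denotations.
record LTS (Ev : Set) : Set where
  field
    nVar : ℕ
    dom  : Fin nVar → ℕ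
    I    : Val nVar dom → Bool
    Tr   : Ev → Val nVar dom → Val nVar dom → Bool

  State : Set
  State = Val nVar dom

open LTS public

data Reachable {Ev : Set} (L : LTS Ev) : State L → Set where
  r-init : ∀ {s} → I L s ≡ true → Reachable L s
  r-step : ∀ {s s'} (e : Ev) → Reachable L s → Tr L e s s' ≡ true → Reachable L s'

Deterministic : {Ev : Set} → LTS Ev → Set
Deterministic {Ev} L =
  (Σ (State L) λ s₀ → (I L s₀ ≡ true) × (∀ s → I L s ≡ true → s ≈V s₀))
  × (∀ s → Reachable L s → ∀ (e : Ev) →
       Σ (State L) λ s' → (Tr L e s s' ≡ true)
                          × (∀ s'' → Tr L e s s'' ≡ true → s'' ≈V s'))

DeadlockFree : {Ev : Set} → LTS Ev → Set
DeadlockFree {Ev} L =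
  ∀ s → Reachable L s → Σ Ev λ e → Σ (State L) λ s' → Tr L e s s' ≡ true

-- Generic transition systems (used for semantics, and for products
-- whose state is the pair of valuations of the disjoint variable sets)

record TS (Ev : Set) : Set₁ where
  field
    St   : Set
    Init : St → Set
    Step : Ev → St → St → Set

open TS public

ltsTS : {Ev : Set} → LTS Ev → TS Ev
ltsTS L = record
  { St = State L
  ; Init = λ s → I L s ≡ true
  ; Step = λ e s s' → Tr L e s s' ≡ true }

record Trace {Ev : Set} (S : TS Ev) : Set where
  field
    st   : ℕ → St S
    ev   : ℕ → Ev
    init : Init S (st 0)
    step : ∀ k → Step S (ev k) (st k) (st (suc k))

open Trace public

-- obs(σ^k), stored in reverse order (most recent first)
obsSeq : {Ev : Set} {S : TS Ev} → (Ev → Bool) → Trace S → ℕ → List Ev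
obsSeq isObs σ zero    = []
obsSeq isObs σ (suc k) =
  if isObs (ev σ k) then ev σ k ∷ obsSeq isObs σ k else obsSeq isObs σ k

ObsPoint : {Ev : Set} {S : TS Ev} → (Ev → Bool) → Trace S → ℕ → Set
ObsPoint isObs σ zero    = ⊥
ObsPoint isObs σ (suc i) = T (isObs (ev σ i))

ObsEq : {Ev : Set} {S : TS Ev} → (Ev → Bool) →
        Trace S → ℕ → Trace S → ℕ → Set
ObsEq isObs σ₁ i σ₂ j =
  ((ObsPoint isObs σ₁ i → ObsPoint isObs σ₂ j)
   × (ObsPoint isObs σ₂ j → ObsPoint isObs σ₁ i))
  × (obsSeq isObs σ₁ i ≡ obsSeq isObs σ₂ j)

Formula : {Ev : Set} → TS Ev → Set₁
Formula S = Trace S → ℕ → Set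

module _ {Ev : Set} {S : TS Ev} where

  _∧F_ : Formula S → Formula S → Formula S
  (φ ∧F ψ) σ i = φ σ i × ψ σ i

  _⇒F_ : Formula S → Formula S → Formula S
  (φ ⇒F ψ) σ i = φ σ i → ψ σ i

  ¬F_ : Formula S → Formula S
  (¬F φ) σ i = ¬ φ σ i

  evF : Ev → Formula S
  evF e σ i = ev σ i ≡ e

  YF : Formula S → Formula S
  YF φ σ zero    = ⊥
  YF φ σ (suc i) = φ σ i

  XF : Formula S → Formula S
  XF φ σ i = φ σ (suc i)

  YFⁿ : ℕ → Formula S → Formula S
  YFⁿ zero    φ = φ
  YFⁿ (suc n) φ = YF (YFⁿ n φ)

  XFⁿ : ℕ → Formula S → Formula S
  XFⁿ zero    φ = φ
  XFⁿ (suc n) φ = XF (XFⁿ n φ)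

  -- O, F, G reflexive
  OF : Formula S → Formula S
  OF φ σ i = Σ ℕ λ j → (j ≤ i) × φ σ j

  FF : Formula S → Formula S
  FF φ σ i = Σ ℕ λ j → (i ≤ j) × φ σ j

  GF : Formula S → Formula S
  GF φ σ i = ∀ j → i ≤ j → φ σ j

  O≤F : ℕ → Formula S → Formula S
  O≤F n φ σ i = Σ ℕ λ k → (k ≤ n) × YFⁿ k φ σ i

  F≤F : ℕ → Formula S → Formula S
  F≤F n φ σ i = Σ ℕ λ k → (k ≤ n) × XFⁿ k φ σ i

  [_]o : (Ev → Bool) → Formula S → Formula S
  [_]o isObs φ = φ ∧F YF (λ σ i → T (isObs (ev σ i)))

  KF : (Ev → Bool) → Formula S → Formula S
  KF isObs φ σ₁ i = ∀ (σ₂ : Trace S) j → ObsEq isObs σ₁ i σ₂ j → φ σ₂ j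

_⊨_ : {Ev : Set} (S : TS Ev) → Formula S → Set
S ⊨ φ = ∀ (σ : Trace S) → φ σ 0

record Plant (nE : ℕ) : Set where
  field
    lts          : LTS (Fin nE)
    isObs        : Fin nE → Bool      -- E_o = { e | isObs e = true }
    deadlockFree : DeadlockFree lts

open Plant public

PState : ∀ {nE} → Plant nE → Set
PState P = State (lts P)

ObsEv : ∀ {nE} → Plant nE → Set
ObsEv {nE} P = Σ (Fin nE) λ e → T (isObs P e)

-- a diagnoser: deterministic LTS over E^P_o (its variables are disjoint
-- from V^P by construction: product states are pairs)
record Diagnoser {nE : ℕ} (P : Plant nE) : Set where
  field
    dlts : LTS (ObsEv P)
    det  : Deterministic dlts

open Diagnoser public

-- a Boolean (alarm) variable of a diagnoser: domain of size 2,
-- value 1 encodes true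
record BoolVar {nE : ℕ} {P : Plant nE} (D : Diagnoser P) : Set where
  field
    var  : Fin (nVar (dlts D))
    bool : dom (dlts D) var ≡ 2

open BoolVar public

AlarmOn : ∀ {nE} {P : Plant nE} {D : Diagnoser P} →
          BoolVar D → State (dlts D) → Set
AlarmOn A s = toℕ (s (var A)) ≡ 1

DP : ∀ {nE} {P : Plant nE} → Diagnoser P → TS (Fin nE)
DP {nE} {P} D = record
  { St   = State (dlts D) × PState P
  ; Init = λ s → (I (dlts D) (proj₁ s) ≡ true) × (I (lts P) (proj₂ s) ≡ true)
  ; Step = λ e s s' →
      (Tr (lts P) e (proj₂ s) (proj₂ s') ≡ true)
      × ((o : T (isObs P e)) → Tr (dlts D) (e , o) (proj₁ s) (proj₁ s') ≡ true)
      × (isObs P e ≡ false → proj₁ s' ≈V proj₁ s) }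


-- ρ is the trace D(σ_P) ⊗ σ_P, i.e. a trace of D ⊗ P whose plant part is σ_P
OverPlant : ∀ {nE} {P : Plant nE} (D : Diagnoser P) →
            Trace (DP D) → Trace (ltsTS (lts P)) → Set
OverPlant D ρ σP =
  ∀ k → (proj₂ (st ρ k) ≈V st σP k) × (ev ρ k ≡ ev σP k)

data DiagCond {nE : ℕ} (P : Plant nE) : Set where
  atom : (PState P → Bool) → DiagCond P
  _∧ᵈ_ : DiagCond P → DiagCond P → DiagCond P
  ¬ᵈ_  : DiagCond P → DiagCond P
  Oᵈ   : DiagCond P → DiagCond P
  Yᵈ   : DiagCond P → DiagCond P

⟦_⟧ : ∀ {nE} {P : Plant nE} → DiagCond P → (D : Diagnoser P) → Formula (DP D)
⟦ atom p ⟧ D σ i = T (p (proj₂ (st σ i)))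
⟦ β ∧ᵈ γ ⟧ D     = ⟦ β ⟧ D ∧F ⟦ γ ⟧ D
⟦ ¬ᵈ β ⟧   D     = ¬F ⟦ β ⟧ D
⟦ Oᵈ β ⟧   D     = OF (⟦ β ⟧ D)
⟦ Yᵈ β ⟧   D     = YF (⟦ β ⟧ D)

alarmF : ∀ {nE} {P : Plant nE} (D : Diagnoser P) → BoolVar D → Formula (DP D)
alarmF D A σ i = AlarmOn A (proj₁ (st σ i))

data DelayKind : Set where
  ExactDel BoundDel FiniteDel : DelayKind

τ : ∀ {nE} {P : Plant nE} (D : Diagnoser P) →
    DelayKind → ℕ → DiagCond P → Formula (DP D)
τ D ExactDel  d β = YFⁿ d (⟦ β ⟧ D)
τ D BoundDel  d β = O≤F d (⟦ β ⟧ D)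
τ D FiniteDel d β = OF (⟦ β ⟧ D)

fut : ∀ {Ev} {S : TS Ev} → DelayKind → ℕ → Formula S → Formula S
fut ExactDel  d = XFⁿ d
fut BoundDel  d = F≤F d
fut FiniteDel d = FF

Correct : ∀ {nE} {P : Plant nE} (D : Diagnoser P) → BoolVar D →
          DelayKind → ℕ → DiagCond P → Set
Correct {P = P} D A k d β =
  DP D ⊨ GF ([ isObs P ]o (alarmF D A) ⇒F τ D k d β)

Maximal : ∀ {nE} {P : Plant nE} (D : Diagnoser P) → BoolVar D →
          DelayKind → ℕ → DiagCond P → Set
Maximal {P = P} D A k d β =
  ∀ (σP : Trace (ltsTS (lts P))) (i : ℕ) → ObsPoint (isObs P) σP i →
  ∀ (ρ : Trace (DP D)) → OverPlant D ρ σP → ¬ AlarmOn A (proj₁ (st ρ i)) →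
  ∀ (D' : Diagnoser P) (A' : BoolVar D') → Correct D' A' k d β →
  ∀ (ρ' : Trace (DP D')) → OverPlant D' ρ' σP → ¬ AlarmOn A' (proj₁ (st ρ' i))

Complete : ∀ {nE} {P : Plant nE} (D : Diagnoser P) → BoolVar D →
           DelayKind → ℕ → DiagCond P → Set
Complete {P = P} D A k d β =
  DP D ⊨ GF ((⟦ β ⟧ D ⇒F fut k d ([ isObs P ]o (KF (isObs P) (τ D k d β))))
             ⇒F (⟦ β ⟧ D ⇒F fut k d ([ isObs P ]o (alarmF D A))))

-- Let σ reach an observation point i at which τ is known, and let w be the
-- observation seen so far. The diagnoser D_w running the automaton that accepts exactly
-- the word w raises its alarm precisely at the observation points where w has been seen.
-- D_w is correct: such a point is observationally equivalent to (σ, i), so knowledge gives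
-- τ there. Since D_w raises its alarm at i on the plant trace of σ, maximality forbids D's
-- alarm from being off at i. Completeness follows because X^d, F^{≤d} and F are monotone.
module Submission where

open import Defs
open import Data.Nat using (ℕ; zero; suc)
import Data.Nat as ℕ
open import Data.Fin using (Fin; zero; suc; toℕ; fromℕ; _≟_)
open import Data.Fin.Properties using (all?; suc-injective)
open import Data.Bool using (Bool; true; false; T; if_then_else_)
open import Data.Bool.Properties using (T-irrelevant)
open import Data.List using (List; []; _∷_; length; foldl; foldr; reverse)
open import Data.List.Properties using (foldr-ʳ++; reverse-involutive; reverse-injective)
open import Data.Product using (Σ; _×_; _,_; proj₁; proj₂)
open import Data.Empty using (⊥-elim)
open import Data.Unit using (tt)
open import Function using (flip; const)
open import Function.Bundles using (_⇔_; mk⇔; Equivalence)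
open import Function.Construct.Composition using (_⇔-∘_)
open Equivalence using (to; from)
open import Relation.Binary.Definitions using (DecidableEquality)
open import Relation.Binary.PropositionalEquality using (_≡_; _≢_; refl; sym; trans; cong; subst)
open import Relation.Nullary using (Dec; yes; no; does)
open import Relation.Nullary.Decidable using (T?; dec-true; decidable-stable)

witness : ∀ {A : Set} (a? : Dec A) → does a? ≡ true → A
witness (yes a) _ = a

_≟V_ : ∀ {n} {dom : Fin n → ℕ} (s t : Val n dom) → Dec (s ≈V t)
s ≟V t = all? (λ x → s x ≟ t x)

module _ {Ev₁ Ev₂ : Set} {S₁ : TS Ev₁} {S₂ : TS Ev₂} {φ : Formula S₁} {ψ : Formula S₂}
         {σ₁ : Trace S₁} {σ₂ : Trace S₂} (φ⇒ψ : ∀ i → φ σ₁ i → ψ σ₂ i) where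

  YFⁿ-mono : ∀ n i → YFⁿ n φ σ₁ i → YFⁿ n ψ σ₂ i
  YFⁿ-mono zero    i       = φ⇒ψ i
  YFⁿ-mono (suc n) (suc i) = YFⁿ-mono n i

  XFⁿ-mono : ∀ n i → XFⁿ n φ σ₁ i → XFⁿ n ψ σ₂ i
  XFⁿ-mono zero    i = φ⇒ψ i
  XFⁿ-mono (suc n) i = XFⁿ-mono n (suc i)

module _ {Ev : Set} {S : TS Ev} {φ ψ : Formula S} {σ : Trace S}
         (φ⇒ψ : ∀ i → φ σ i → ψ σ i) where

  fut-mono : ∀ k d i → fut k d φ σ i → fut k d ψ σ i
  fut-mono ExactDel  d i                 = XFⁿ-mono φ⇒ψ d i
  fut-mono BoundDel  d i (n , n≤d , x) = n , n≤d , XFⁿ-mono φ⇒ψ n i x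
  fut-mono FiniteDel d i (j , i≤j , x) = j , i≤j , φ⇒ψ j x

module _ {nE} {P : Plant nE} {D₁ D₂ : Diagnoser P}
         {σ₁ : Trace (DP D₁)} {σ₂ : Trace (DP D₂)}
         (samePlant : ∀ k → proj₂ (st σ₁ k) ≡ proj₂ (st σ₂ k)) where

  ⟦⟧-plantOnly : ∀ β i → ⟦ β ⟧ D₁ σ₁ i ⇔ ⟦ β ⟧ D₂ σ₂ i
  ⟦⟧-plantOnly (atom p) i =
    mk⇔ (subst (λ s → T (p s)) (samePlant i)) (subst (λ s → T (p s)) (sym (samePlant i)))
  ⟦⟧-plantOnly (β ∧ᵈ γ) i =
    mk⇔ (λ (b , c) → to (⟦⟧-plantOnly β i) b , to (⟦⟧-plantOnly γ i) c)
        (λ (b , c) → from (⟦⟧-plantOnly β i) b , from (⟦⟧-plantOnly γ i) c)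
  ⟦⟧-plantOnly (¬ᵈ β) i =
    mk⇔ (λ ¬b b → ¬b (from (⟦⟧-plantOnly β i) b))
        (λ ¬b b → ¬b (to (⟦⟧-plantOnly β i) b))
  ⟦⟧-plantOnly (Oᵈ β) i =
    mk⇔ (λ (j , j≤i , b) → j , j≤i , to (⟦⟧-plantOnly β j) b)
        (λ (j , j≤i , b) → j , j≤i , from (⟦⟧-plantOnly β j) b)
  ⟦⟧-plantOnly (Yᵈ β) zero    = mk⇔ (λ ()) (λ ())
  ⟦⟧-plantOnly (Yᵈ β) (suc i) = ⟦⟧-plantOnly β i

  τ-plantOnly : ∀ k d β i → τ D₁ k d β σ₁ i → τ D₂ k d β σ₂ i
  τ-plantOnly ExactDel  d β i = YFⁿ-mono (λ j → to (⟦⟧-plantOnly β j)) d i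
  τ-plantOnly BoundDel  d β i (n , n≤d , b) =
    n , n≤d , YFⁿ-mono (λ j → to (⟦⟧-plantOnly β j)) n i b
  τ-plantOnly FiniteDel d β i (j , j≤i , b) = j , j≤i , to (⟦⟧-plantOnly β j) b

module _ {nE} {P : Plant nE} (D : Diagnoser P) where

  plantTrace : Trace (DP D) → Trace (ltsTS (lts P))
  plantTrace ρ = record
    { st   = λ k → proj₂ (st ρ k)
    ; ev   = ev ρ
    ; init = proj₂ (init ρ)
    ; step = λ k → proj₁ (step ρ k) }

  private
    ReachableState : Set
    ReachableState = Σ (State (dlts D)) (Reachable (dlts D))

    DiagnoserMove : Fin nE → State (dlts D) → State (dlts D) → Set
    DiagnoserMove e s s' =
      ((o : T (isObs P e)) → Tr (dlts D) (e , o) s s' ≡ true) × (isObs P e ≡ false → s' ≈V s)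

    react : ReachableState → (e : Fin nE) → Dec (T (isObs P e)) → ReachableState
    react (s , r) e (yes o) =
      let (s' , moved , _) = proj₂ (det D) s r (e , o) in s' , r-step (e , o) r moved
    react sr e (no _) = sr

    react-moves : ∀ sr e → DiagnoserMove e (proj₁ sr) (proj₁ (react sr e (T? (isObs P e))))
    react-moves (s , r) e with T? (isObs P e)
    ... | yes o = (λ o′ → subst (λ o″ → Tr (dlts D) (e , o″) s _ ≡ true) (T-irrelevant o o′)
                                (proj₁ (proj₂ (proj₂ (det D) s r (e , o)))))
                , (λ unobs → ⊥-elim (subst T unobs o))
    ... | no ¬o = (λ o → ⊥-elim (¬o o)) , (λ _ _ → refl)

    initial : ReachableState
    initial = let (s₀ , s₀-init , _) = proj₁ (det D) in s₀ , r-init s₀-init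

  productTrace : Trace (ltsTS (lts P)) → Trace (DP D)
  productTrace σP = record
    { st   = λ k → proj₁ (diagnoserState k) , st σP k
    ; ev   = ev σP
    ; init = proj₁ (proj₂ (proj₁ (det D))) , init σP
    ; step = λ k → step σP k , react-moves (diagnoserState k) (ev σP k) }
    where
      diagnoserState : ℕ → ReachableState
      diagnoserState zero    = initial
      diagnoserState (suc k) = react (diagnoserState k) (ev σP k) (T? (isObs P (ev σP k)))

module _ {Ev : Set} {n : ℕ} {dom : Fin n → ℕ}
         (s₀ : Val n dom) (next : Ev → Val n dom → Val n dom) where

  functionalLTS : LTS Ev
  functionalLTS = record
    { nVar = n
    ; dom  = dom
    ; I    = λ s → does (s ≟V s₀)
    ; Tr   = λ e s s' → does (s' ≟V next e s) }

  functionalLTS-init : ∀ s → I functionalLTS s ≡ true → s ≈V s₀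
  functionalLTS-init s = witness (s ≟V s₀)

  functionalLTS-step : ∀ e s s' → Tr functionalLTS e s s' ≡ true → s' ≈V next e s
  functionalLTS-step e s s' = witness (s' ≟V next e s)

  functionalLTS-deterministic : Deterministic functionalLTS
  functionalLTS-deterministic =
      (s₀ , dec-true (s₀ ≟V s₀) (λ _ → refl) , functionalLTS-init)
    , λ s _ e →
        next e s , dec-true (next e s ≟V next e s) (λ _ → refl) , functionalLTS-step e s

bit : Bool → Fin 2
bit false = zero
bit true  = suc zero

toℕ-bit : ∀ b → toℕ (bit b) ≡ 1 ⇔ b ≡ true
toℕ-bit false = mk⇔ (λ ()) (λ ())
toℕ-bit true  = mk⇔ (λ _ → refl) (λ _ → refl)

module Recognizer {nE} (P : Plant nE) {n : ℕ}
                  (q₀ : Fin n) (δ : Fin n → Fin nE → Fin n) (accept : Fin n → Bool) where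

  domain : Fin 2 → ℕ
  domain zero    = 2
  domain (suc _) = n

  encode : Fin n → Val 2 domain
  encode q zero       = bit (accept q)
  encode q (suc zero) = q

  next : ObsEv P → Val 2 domain → Val 2 domain
  next (e , _) s = encode (δ (s (suc zero)) e)

  diagnoser : Diagnoser P
  diagnoser = record
    { dlts = functionalLTS (encode q₀) next
    ; det  = functionalLTS-deterministic (encode q₀) next }

  alarm : BoolVar diagnoser
  alarm = record { var = zero ; bool = refl }

  run : List (Fin nE) → Fin n
  run = foldr (flip δ) q₀

  state≈run : (ρ : Trace (DP diagnoser)) →
              ∀ j → proj₁ (st ρ j) ≈V encode (run (obsSeq (isObs P) ρ j))
  state≈run ρ zero = functionalLTS-init (encode q₀) next _ (proj₁ (init ρ))
  state≈run ρ (suc j) with isObs P (ev ρ j) in observable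
  ... | true = λ x →
    trans (functionalLTS-step (encode q₀) next (ev ρ j , o) (proj₁ (st ρ j))
                              (proj₁ (st ρ (suc j))) (proj₁ (proj₂ (step ρ j)) o) x)
          (cong (λ q → encode (δ q (ev ρ j)) x) (state≈run ρ j (suc zero)))
    where o = subst T (sym observable) tt
  ... | false = λ x → trans (proj₂ (proj₂ (step ρ j)) observable x) (state≈run ρ j x)

  alarm⇔accept : (ρ : Trace (DP diagnoser)) → ∀ j →
                 alarmF diagnoser alarm ρ j ⇔ accept (run (obsSeq (isObs P) ρ j)) ≡ true
  alarm⇔accept ρ j =
    subst (λ b → toℕ b ≡ 1 ⇔ accept q ≡ true) (sym (state≈run ρ j zero)) (toℕ-bit (accept q))
    where q = run (obsSeq (isObs P) ρ j)

-- States of the automaton for u: state i ≤ length u means that the first i letters of u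
-- have been read; the last state is a sink entered on any deviation from u.
module WordAutomaton {A : Set} (_≟ᴬ_ : DecidableEquality A) where

  Matched : List A → Set
  Matched u = Fin (suc (suc (length u)))

  deviated : (u : List A) → Matched u
  deviated u = fromℕ (suc (length u))

  complete : (u : List A) → Matched u
  complete []      = zero
  complete (_ ∷ u) = suc (complete u)

  advance : (u : List A) → Matched u → A → Matched u
  advance []      _       _ = deviated []
  advance (x ∷ u) zero    e = if does (e ≟ᴬ x) then suc zero else deviated (x ∷ u)
  advance (x ∷ u) (suc i) e = suc (advance u i e)

  feed : (u : List A) → Matched u → List A → Matched u
  feed u = foldl (advance u)

  deviated≢complete : ∀ u → deviated u ≢ complete u
  deviated≢complete []      ()
  deviated≢complete (_ ∷ u) eq = deviated≢complete u (suc-injective eq)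

  feed-deviated : ∀ u v → feed u (deviated u) v ≡ deviated u
  feed-deviated u []      = refl
  feed-deviated u (e ∷ v) =
    trans (cong (λ i → feed u i v) (advance-deviated u)) (feed-deviated u v)
    where
      advance-deviated : ∀ u → advance u (deviated u) e ≡ deviated u
      advance-deviated []      = refl
      advance-deviated (_ ∷ u) = cong suc (advance-deviated u)

  feed-suc : ∀ x u i v → feed (x ∷ u) (suc i) v ≡ suc (feed u i v)
  feed-suc x u i []      = refl
  feed-suc x u i (e ∷ v) = feed-suc x u (advance u i e) v

  feed-self : ∀ u → feed u zero u ≡ complete u
  feed-self []      = refl
  feed-self (x ∷ u) with x ≟ᴬ x
  ... | yes _  = trans (feed-suc x u zero u) (cong suc (feed-self u))
  ... | no x≢x = ⊥-elim (x≢x refl)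

  feed-complete⇒≡ : ∀ u v → feed u zero v ≡ complete u → v ≡ u
  feed-complete⇒≡ []      []      _  = refl
  feed-complete⇒≡ []      (e ∷ v) eq =
    ⊥-elim (deviated≢complete [] (trans (sym (feed-deviated [] v)) eq))
  feed-complete⇒≡ (x ∷ u) []      ()
  feed-complete⇒≡ (x ∷ u) (e ∷ v) eq with e ≟ᴬ x
  ... | yes refl =
    cong (x ∷_) (feed-complete⇒≡ u v (suc-injective (trans (sym (feed-suc x u zero v)) eq)))
  ... | no _     =
    ⊥-elim (deviated≢complete (x ∷ u) (trans (sym (feed-deviated (x ∷ u) v)) eq))

module ObservationRecognizer {nE} (P : Plant nE) (w : List (Fin nE)) where

  open WordAutomaton (_≟_ {nE})

  -- obsSeq lists the most recent event first, the automaton reads oldest first.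
  private
    u : List (Fin nE)
    u = reverse w

    accepting : Matched u → Bool
    accepting i = does (i ≟ complete u)

  open Recognizer P zero (advance u) accepting public

  run≡feed : ∀ l → run l ≡ feed u zero (reverse l)
  run≡feed l = trans (cong run (sym (reverse-involutive l)))
                     (foldr-ʳ++ (flip (advance u)) zero (reverse l))

  accepting⇔≡ : ∀ l → accepting (run l) ≡ true ⇔ l ≡ w
  accepting⇔≡ l = mk⇔
    (λ acc → reverse-injective (feed-complete⇒≡ u (reverse l)
               (trans (sym (run≡feed l)) (witness (run l ≟ complete u) acc))))
    (λ { refl → dec-true (run w ≟ complete u) (trans (run≡feed w) (feed-self u)) })

  alarm⇔observed : (ρ : Trace (DP diagnoser)) → ∀ j →
                   alarmF diagnoser alarm ρ j ⇔ obsSeq (isObs P) ρ j ≡ w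
  alarm⇔observed ρ j = accepting⇔≡ (obsSeq (isObs P) ρ j) ⇔-∘ alarm⇔accept ρ j

obsSeq-cong : ∀ {Ev : Set} {S₁ S₂ : TS Ev} (isObs : Ev → Bool)
              (σ₁ : Trace S₁) (σ₂ : Trace S₂) →
              (∀ k → ev σ₁ k ≡ ev σ₂ k) → ∀ i → obsSeq isObs σ₁ i ≡ obsSeq isObs σ₂ i
obsSeq-cong isObs σ₁ σ₂ sameEv zero = refl
obsSeq-cong isObs σ₁ σ₂ sameEv (suc i)
  rewrite sameEv i | obsSeq-cong isObs σ₁ σ₂ sameEv i = refl

[]o⇒ObsPoint : ∀ {Ev : Set} {S : TS Ev} (isObs : Ev → Bool) (φ : Formula S) (σ : Trace S) →
               ∀ i →
               [ isObs ]o φ σ i → ObsPoint isObs σ i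
[]o⇒ObsPoint isObs φ σ zero    (_ , ())
[]o⇒ObsPoint isObs φ σ (suc i) (_ , observable) = observable

module _ {nE} {P : Plant nE} (D : Diagnoser P) (k : DelayKind) (d : ℕ) (β : DiagCond P)
         (σ : Trace (DP D)) (i : ℕ) where

  open ObservationRecognizer P (obsSeq (isObs P) σ i)

  known⇒recognizer-correct : [ isObs P ]o (KF (isObs P) (τ D k d β)) σ i →
                             Correct diagnoser alarm k d β
  known⇒recognizer-correct _ ρ zero _ (_ , ())
  known⇒recognizer-correct known ρ (suc j) _ (alarmOn , observableⱼ) =
    τ-plantOnly (λ _ → refl) k d β (suc j)
      (proj₁ known σ′ (suc j) ((const observableⱼ , const observableᵢ) , sameObs))
    where
      observableᵢ : ObsPoint (isObs P) σ i
      observableᵢ = []o⇒ObsPoint (isObs P) (KF (isObs P) (τ D k d β)) σ i known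
      σ′ : Trace (DP D)
      σ′ = productTrace D (plantTrace diagnoser ρ)
      sameObs : obsSeq (isObs P) σ i ≡ obsSeq (isObs P) σ′ (suc j)
      sameObs = sym (trans (obsSeq-cong (isObs P) σ′ ρ (λ _ → refl) (suc j))
                           (to (alarm⇔observed ρ (suc j)) alarmOn))

  recognizer-alarmOn : alarmF diagnoser alarm (productTrace diagnoser (plantTrace D σ)) i
  recognizer-alarmOn = from (alarm⇔observed ρ i) (obsSeq-cong (isObs P) ρ σ (λ _ → refl) i)
    where ρ = productTrace diagnoser (plantTrace D σ)

maximal⇒known⇒alarm : ∀ {nE} {P : Plant nE} (D : Diagnoser P) (A : BoolVar D) k d β →
                      Maximal D A k d β → ∀ (σ : Trace (DP D)) i →
                      [ isObs P ]o (KF (isObs P) (τ D k d β)) σ i →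
                      [ isObs P ]o (alarmF D A) σ i
maximal⇒known⇒alarm D A k d β maximal σ zero (_ , ())
maximal⇒known⇒alarm {P = P} D A k d β maximal σ (suc i) known@(_ , observable) =
  raised , observable
  where
    open ObservationRecognizer P (obsSeq (isObs P) σ (suc i))
    raised : AlarmOn A (proj₁ (st σ (suc i)))
    raised = decidable-stable (toℕ (proj₁ (st σ (suc i)) (var A)) ℕ.≟ 1) λ notRaised →
      maximal (plantTrace D σ) (suc i) observable σ (λ _ → (λ _ → refl) , refl) notRaised
              diagnoser alarm (known⇒recognizer-correct D k d β σ (suc i) known)
              (productTrace diagnoser (plantTrace D σ)) (λ _ → (λ _ → refl) , refl)
              (recognizer-alarmOn D k d β σ (suc i))

theorem4p3 : ∀ {nE : ℕ} (P : Plant nE) (D : Diagnoser P) (A : BoolVar D)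
    (β : DiagCond P) (d : ℕ) (k : DelayKind) →
    Maximal D A k d β → Complete D A k d β
theorem4p3 P D A β d k maximal σ j _ promise βⱼ =
  fut-mono (maximal⇒known⇒alarm D A k d β maximal σ) k d j (promise βⱼ)
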